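{- Let $\Lambda,\Gamma$ be $S$-sorted sets of formulas, $s\in S$ and $\varphi,\psi\in Form_s$. Then $\Gamma\vdash_{\mathbf K\Lambda}\varphi\to\psi$ if and only if $(\Gamma_G)_s\cup\{\varphi\}\vdash^s_{\mathbf K\Lambda}\psi$.
   Context: Let $(S,\Sigma)$ be a many-sorted signature (each $\sigma\in\Sigma$ has a type $s_1\ldots s_n\to s$, $n\ge0$; $\Sigma_{s_1\ldots s_n,s}$ the symbols of that type; $[n]=\{1,\ldots,n\}$), and $P=\{P_s\}_{s\in S}$ nonempty pairwise disjoint sets of propositional variables. Formulas $Form_s$: $P_s\subseteq Form_s$, closure under $\neg,\vee$ within a sort, and $\sigma(\phi_1,\ldots,\phi_n)\in Form_s$ for $\sigma\in\Sigma_{s_1\ldots s_n,s}$, $\phi_i\in Form_{s_i}$. Abbreviations: $\wedge,\to,\leftrightarrow$; for $n\ge1$, $\sigma^\Box(\phi_1,\ldots,\phi_n):=\neg\sigma(\neg\phi_1,\ldots,\neg\phi_n)$. $\mathbf K=\{\mathbf K_s\}$: the least $S$-sorted set containing in each sort all classical propositional theorems and, for $n\ge1$, $\sigma\in\Sigma_{s_1\ldots s_n,s}$, $i\in[n]$, $\psi_j\in Form_{s_j}$, $\phi,\chi\in Form_{s_i}$, the axioms $\sigma^\Box(\ldots,\phi\to\chi,\ldots)\to(\sigma^\Box(\ldots,\phi,\ldots)\to\sigma^\Box(\ldots,\chi,\ldots))$ (position $i$, other arguments $\psi_j$) and $\sigma(\psi_1,\ldots,\psi_n)\leftrightarrow\neg\sigma^\Box(\neg\psi_1,\ldots,\neg\psi_n)$.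 $\mathbf K\Lambda_s$ is $\mathbf K_s$ plus all sort-preserving uniform substitution instances of formulas of $\Lambda_s$. Rules: modus ponens (MP) within a sort; universal generalization (UG): from $\phi\in Form_{s_i}$ infer $\sigma^\Box(\psi_1,\ldots,\psi_{i-1},\phi,\psi_{i+1},\ldots,\psi_n)$ for $\sigma\in\Sigma_{s_1\ldots s_n,s}$, $n\ge1$, $i\in[n]$. $\vdash^s_{\mathbf K\Lambda}\phi$ means $\phi\in Form_s$ has a finite proof from $\mathbf K\Lambda$ using MP and UG; for $\Phi_s\subseteq Form_s$, $\Phi_s\vdash^s_{\mathbf K\Lambda}\phi$ (local deduction) means there are $\phi_1,\ldots,\phi_n\in\Phi_s$ with $\vdash^s_{\mathbf K\Lambda}(\phi_1\wedge\cdots\wedge\phi_n)\to\phi$. Global deduction: for an $S$-sorted set $\Gamma=\{\Gamma_s\}$ and $\phi\in Form_s$, $\Gamma\vdash_{\mathbf K\Lambda}\phi$ means there is a sequence $\phi_1,\ldots,\phi_m=\phi$ of formulas (of arbitrary sorts $s_i$) each in $\mathbf K\Lambda_{s_i}$, or in $\Gamma_{s_i}$, or following from earlier ones by MP or UG. $\Gamma_G=\bigcup_k\Gamma^k$ where $\Gamma^0=\Gamma$ and $\Gamma^{k+1}_s=\Gamma^k_s\cup\{\sigma^\Box(\psi_1,\ldots,\psi_{i-1},\gamma,\psi_{i+1},\ldots,\psi_n)\mid \sigma\in\Sigma_{s_1\ldots s_n,s},n\ge1,i\in[n],\gamma\in\Gamma^k_{s_i},\psi_j\in Form_{s_j}\}$.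 -}

module Defs where

open import Data.Bool using (Bool; true; false; not; _∨_)
open import Data.List using (List; []; _∷_)
open import Data.List.Relation.Unary.All as All using (All; []; _∷_; updateAt)
open import Data.List.Membership.Propositional using (_∈_)
open import Data.Product using (Σ; _×_; _,_)
open import Data.Sum using (_⊎_)
open import Data.Empty using (⊥)
open import Relation.Binary.PropositionalEquality using (_≡_)

-- S   : the set of sorts
--   Sym : Sym ss s = Σ_{s1...sn, s}, the symbols of type s1 ... sn → s  (ss = s1 ∷ ... ∷ sn)
--   P   : P s = the propositional variables of sort s (disjointness is automatic:
--         variables of different sorts live in different types)
module Logic (S : Set) (Sym : List S → S → Set) (P : S → Set) where

  data Form (s : S) : Set where
    var  : P s → Form s
    ~_   : Form s → Form s
    _∨̇_  : Form s → Form s → Form s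
    app  : ∀ {ss} → Sym ss s → All Form ss → Form s

  infix  7 ~_
  infixr 6 _∧̇_
  infixr 5 _∨̇_
  infixr 4 _⇒_
  infix  3 _⇔̇_

  _∧̇_ : ∀ {s} → Form s → Form s → Form s
  φ ∧̇ ψ = ~ (~ φ ∨̇ ~ ψ)

  _⇒_ : ∀ {s} → Form s → Form s → Form s
  φ ⇒ ψ = ~ φ ∨̇ ψ

  _⇔̇_ : ∀ {s} → Form s → Form s → Form s
  φ ⇔̇ ψ = (φ ⇒ ψ) ∧̇ (ψ ⇒ φ)

  box : ∀ {ss s} → Sym ss s → All Form ss → Form s
  box σ φs = ~ app σ (All.map ~_ φs)

  _[_≔_] : ∀ {ss t} → All Form ss → t ∈ ss → Form t → All Form ss
  ψs [ i ≔ φ ] = updateAt i (λ _ → φ) ψs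

  FSet : Set₁
  FSet = (s : S) → Form s → Set

  -- Classical propositional tautologies (variables and σ(…)-formulas are atoms)
  ⟦_⟧ : ∀ {s} → Form s → (Form s → Bool) → Bool
  ⟦ var p ⟧    v = v (var p)
  ⟦ ~ φ ⟧      v = not (⟦ φ ⟧ v)
  ⟦ φ ∨̇ ψ ⟧    v = ⟦ φ ⟧ v ∨ ⟦ ψ ⟧ v
  ⟦ app σ φs ⟧ v = v (app σ φs)

  Taut : ∀ {s} → Form s → Set
  Taut {s} φ = (v : Form s → Bool) → ⟦ φ ⟧ v ≡ true

  Subst : Set
  Subst = ∀ {s} → P s → Form s

  mutual
    sub : Subst → ∀ {s} → Form s → Form s
    sub θ (var p)    = θ p
    sub θ (~ φ)      = ~ sub θ φ
    sub θ (φ ∨̇ ψ)    = sub θ φ ∨̇ sub θ ψ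
    sub θ (app σ φs) = app σ (subs θ φs)

    subs : Subst → ∀ {ss} → All Form ss → All Form ss
    subs θ []       = []
    subs θ (φ ∷ φs) = sub θ φ ∷ subs θ φs

  data KΛ (Λ : FSet) : (s : S) → Form s → Set where
    taut : ∀ {s} {φ : Form s} → Taut φ → KΛ Λ s φ
    kAx  : ∀ {t ts s} (σ : Sym (t ∷ ts) s) {u} (i : u ∈ (t ∷ ts))
             (ψs : All Form (t ∷ ts)) (φ χ : Form u) →
             KΛ Λ s (box σ (ψs [ i ≔ φ ⇒ χ ]) ⇒ (box σ (ψs [ i ≔ φ ]) ⇒ box σ (ψs [ i ≔ χ ])))
    dual : ∀ {t ts s} (σ : Sym (t ∷ ts) s) (ψs : All Form (t ∷ ts)) →
             KΛ Λ s (app σ ψs ⇔̇ ~ box σ (All.map ~_ ψs))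
    inst : ∀ {s} {φ : Form s} (θ : Subst) → Λ s φ → KΛ Λ s (sub θ φ)

  -- Global deduction Γ ⊢_{KΛ} φ (axioms of KΛ, hypotheses from Γ, MP, UG);
  -- a finite derivation tree, equivalently a finite proof sequence.
  data _⨾_⊢G_ (Λ Γ : FSet) : ∀ {s} → Form s → Set where
    ax  : ∀ {s} {φ : Form s} → KΛ Λ s φ → Λ ⨾ Γ ⊢G φ
    hyp : ∀ {s} {φ : Form s} → Γ s φ → Λ ⨾ Γ ⊢G φ
    mp  : ∀ {s} {φ ψ : Form s} → Λ ⨾ Γ ⊢G (φ ⇒ ψ) → Λ ⨾ Γ ⊢G φ → Λ ⨾ Γ ⊢G ψ
    ug  : ∀ {ss s t} (σ : Sym ss s) (i : t ∈ ss) (ψs : All Form ss) {φ : Form t} →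
            Λ ⨾ Γ ⊢G φ → Λ ⨾ Γ ⊢G box σ (ψs [ i ≔ φ ])

  ∅ : FSet
  ∅ _ _ = ⊥

  _⊢_ : (Λ : FSet) → ∀ {s} → Form s → Set
  Λ ⊢ φ = Λ ⨾ ∅ ⊢G φ

  -- (φ1 ∧ … ∧ φn) → ψ ; for n = 0 this is just ψ
  conj : ∀ {s} → Form s → List (Form s) → Form s
  conj φ []       = φ
  conj φ (χ ∷ χs) = φ ∧̇ conj χ χs

  _⇛_ : ∀ {s} → List (Form s) → Form s → Form s
  []       ⇛ ψ = ψ
  (φ ∷ φs) ⇛ ψ = conj φ φs ⇒ ψ

  _⨾_⊢L_ : (Λ : FSet) → ∀ {s} → (Form s → Set) → Form s → Set
  _⨾_⊢L_ Λ {s} Φ ψ = Σ (List (Form s)) λ φs → All Φ φs × (Λ ⊢ (φs ⇛ ψ))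

  data _ᴳ (Γ : FSet) : FSet where
    base : ∀ {s} {γ : Form s} → Γ s γ → (Γ ᴳ) s γ
    step : ∀ {ss s t} (σ : Sym ss s) (i : t ∈ ss) (ψs : All Form ss) {γ : Form t} →
             (Γ ᴳ) t γ → (Γ ᴳ) s (box σ (ψs [ i ≔ γ ]))

  _∪｛_｝ : ∀ {s} → (Form s → Set) → Form s → (Form s → Set)
  (Φ ∪｛ φ ｝) χ = Φ χ ⊎ χ ≡ φ

-- A global derivation may apply UG to hypotheses, a local one may not. But UG can be
-- pushed down to the hypotheses: if ⊢ γ₁ → ⋯ → γₙ → χ, then UG and the K axiom give
-- σ^□(…χ…) locally from the formulas σ^□(…γₖ…), which lie in Γ_G. So global consequence
-- from Γ is local consequence from (Γ_G)_s, and local consequence, being defined by a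
-- single implication, satisfies the classical deduction theorem.
module Submission where

open import Defs
open import Data.Bool using (Bool; true; false; not; _∨_)
open import Data.List using (List; []; _∷_; _++_; [_])
open import Data.List.Relation.Unary.All as All using (All; []; _∷_)
open import Data.List.Relation.Unary.All.Properties using (++⁺; ++⁻)
open import Data.List.Relation.Unary.Any using (here; there)
open import Data.List.Membership.Propositional using (_∈_)
open import Data.Product using (∃-syntax; _×_; _,_; map)
open import Data.Sum using (inj₁; inj₂)
open import Function using (_∘_; id)
open import Function.Bundles using (_⇔_; mk⇔)
open import Function.Construct.Composition using (_⇔-∘_)
open import Relation.Binary.PropositionalEquality using (_≡_; refl; subst)

module Deduction (S : Set) (Sym : List S → S → Set) (P : S → Set) where
  open Logic S Sym P

  module _ {s : S} where

    -- A record rather than ⟦ φ ⟧ v ≡ true, so that v and φ can be inferred from it.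
    record _⊨_ (v : Form s → Bool) (φ : Form s) : Set where
      constructor holds
      field truth : ⟦ φ ⟧ v ≡ true
    open _⊨_ public

    module _ {v : Form s → Bool} where

      ⇒-intro : ∀ {φ ψ} → (v ⊨ φ → v ⊨ ψ) → v ⊨ (φ ⇒ ψ)
      ⇒-intro {φ} f = holds (lemma (⟦ φ ⟧ v) (truth ∘ f ∘ holds))
        where
        lemma : ∀ x {y} → (x ≡ true → y ≡ true) → not x ∨ y ≡ true
        lemma true  g = g refl
        lemma false g = refl

      ⇒-elim : ∀ {φ ψ} → v ⊨ (φ ⇒ ψ) → v ⊨ φ → v ⊨ ψ
      ⇒-elim {ψ = ψ} (holds f) (holds p) = holds (subst (λ b → not b ∨ ⟦ ψ ⟧ v ≡ true) p f)

      ∧-intro : ∀ {φ ψ} → v ⊨ φ → v ⊨ ψ → v ⊨ (φ ∧̇ ψ)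
      ∧-intro (holds p) (holds q) = holds (lemma p q)
        where
        lemma : ∀ {x y} → x ≡ true → y ≡ true → not (not x ∨ not y) ≡ true
        lemma refl refl = refl

      ∧-elim : ∀ {φ ψ} → v ⊨ (φ ∧̇ ψ) → v ⊨ φ × v ⊨ ψ
      ∧-elim {φ} {ψ} (holds h) = map holds holds (lemma (⟦ φ ⟧ v) (⟦ ψ ⟧ v) h)
        where
        lemma : ∀ x y → not (not x ∨ not y) ≡ true → x ≡ true × y ≡ true
        lemma true true _ = refl , refl

      conj-intro : ∀ φ φs → All (v ⊨_) (φ ∷ φs) → v ⊨ conj φ φs
      conj-intro φ []       (p ∷ []) = p
      conj-intro φ (χ ∷ χs) (p ∷ ps) = ∧-intro p (conj-intro χ χs ps)

      conj-elim : ∀ φ φs → v ⊨ conj φ φs → All (v ⊨_) (φ ∷ φs)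
      conj-elim φ []       p = p ∷ []
      conj-elim φ (χ ∷ χs) h = let p , q = ∧-elim {φ} h in p ∷ conj-elim χ χs q

      ⇛-intro : ∀ φs {χ} → (All (v ⊨_) φs → v ⊨ χ) → v ⊨ (φs ⇛ χ)
      ⇛-intro []       f = f []
      ⇛-intro (φ ∷ φs) f = ⇒-intro (f ∘ conj-elim φ φs)

      ⇛-elim : ∀ φs {χ} → v ⊨ (φs ⇛ χ) → All (v ⊨_) φs → v ⊨ χ
      ⇛-elim []       p []           = p
      ⇛-elim (φ ∷ φs) p ps@(_ ∷ _) = ⇒-elim p (conj-intro φ φs ps)

  -- The curried form γ₁ ⇒ ⋯ ⇒ γₙ ⇒ χ of φs ⇛ χ, which UG and the K axiom can take apart.
  curry : ∀ {s} → List (Form s) → Form s → Form s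
  curry []       χ = χ
  curry (γ ∷ γs) χ = γ ⇒ curry γs χ

  curry-intro : ∀ {s} {v : Form s → Bool} γs {χ} → (All (v ⊨_) γs → v ⊨ χ) → v ⊨ curry γs χ
  curry-intro []       f = f []
  curry-intro (γ ∷ γs) f = ⇒-intro λ p → curry-intro γs (f ∘ (p ∷_))

  module _ {Λ Γ : FSet} where

    tautological-mp : ∀ {s} {A C : Form s} →
                      Λ ⨾ Γ ⊢G A → (∀ {v} → v ⊨ A → v ⊨ C) → Λ ⨾ Γ ⊢G C
    tautological-mp d f = mp (ax (taut λ _ → truth (⇒-intro f))) d

    tautological-mp₂ : ∀ {s} {A B C : Form s} →
                       Λ ⨾ Γ ⊢G A → Λ ⨾ Γ ⊢G B → (∀ {v} → v ⊨ A → v ⊨ B → v ⊨ C) →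
                       Λ ⨾ Γ ⊢G C
    tautological-mp₂ d e f = mp (mp (ax (taut λ _ → truth (⇒-intro (⇒-intro ∘ f)))) d) e

    ⇛⇒curry : ∀ {s} (γs : List (Form s)) {χ} → Λ ⨾ Γ ⊢G (γs ⇛ χ) → Λ ⨾ Γ ⊢G curry γs χ
    ⇛⇒curry γs d = tautological-mp d (curry-intro γs ∘ ⇛-elim γs)

    mp-all : ∀ {s} {γs : List (Form s)} {χ} →
             All (λ γ → Λ ⨾ Γ ⊢G γ) γs → Λ ⨾ Γ ⊢G curry γs χ → Λ ⨾ Γ ⊢G χ
    mp-all []       d = d
    mp-all (e ∷ es) d = mp-all es (mp d e)

    theorem⇒derivable : ∀ {s} {χ : Form s} → Λ ⊢ χ → Λ ⨾ Γ ⊢G χ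
    theorem⇒derivable (ax k)        = ax k
    theorem⇒derivable (mp d e)      = mp (theorem⇒derivable d) (theorem⇒derivable e)
    theorem⇒derivable (ug σ i ψs d) = ug σ i ψs (theorem⇒derivable d)

    ᴳ⇒derivable : ∀ {s} {γ : Form s} → (Γ ᴳ) s γ → Λ ⨾ Γ ⊢G γ
    ᴳ⇒derivable (base h)        = hyp h
    ᴳ⇒derivable (step σ i ψs g) = ug σ i ψs (ᴳ⇒derivable g)

  -- kAx only covers nonempty argument lists; matching on the position i exposes that shape.
  distribution : ∀ {Λ ss s u} (σ : Sym ss s) (i : u ∈ ss) (ψs : All Form ss) (φ χ : Form u) →
                 KΛ Λ s (box σ (ψs [ i ≔ φ ⇒ χ ]) ⇒ (box σ (ψs [ i ≔ φ ]) ⇒ box σ (ψs [ i ≔ χ ])))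
  distribution σ i@(here _)  = kAx σ i
  distribution σ i@(there _) = kAx σ i

  module _ {Λ : FSet} {s : S} {Φ : Form s → Set} where

    local-thm : ∀ {χ} → Λ ⊢ χ → Λ ⨾ Φ ⊢L χ
    local-thm d = [] , [] , d

    local-hyp : ∀ {χ} → Φ χ → Λ ⨾ Φ ⊢L χ
    local-hyp {χ} h = [ χ ] , h ∷ [] , ax (taut λ _ → truth (⇒-intro {φ = χ} id))

    local-mp : ∀ {φ ψ} → Λ ⨾ Φ ⊢L (φ ⇒ ψ) → Λ ⨾ Φ ⊢L φ → Λ ⨾ Φ ⊢L ψ
    local-mp (γs , hs , d) (δs , gs , e) =
      γs ++ δs , ++⁺ hs gs ,
      tautological-mp₂ d e λ f g → ⇛-intro (γs ++ δs) λ ps →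
        let qs , rs = ++⁻ γs ps in ⇒-elim (⇛-elim γs f qs) (⇛-elim δs g rs)

    All-∪｛｝ : ∀ {φ γs} → All (Φ ∪｛ φ ｝) γs →
                ∃[ δs ] All Φ δs × (∀ {Q : Form s → Set} → Q φ → All Q δs → All Q γs)
    All-∪｛｝ [] = [] , [] , λ _ _ → []
    All-∪｛｝ (inj₁ h ∷ hs) with All-∪｛｝ hs
    ... | δs , gs , cover = _ ∷ δs , h ∷ gs , λ { p (q ∷ qs) → q ∷ cover p qs }
    All-∪｛｝ (inj₂ refl ∷ hs) with All-∪｛｝ hs
    ... | δs , gs , cover = δs , gs , λ p qs → p ∷ cover p qs

    local-deduction : ∀ {φ ψ} → (Λ ⨾ Φ ⊢L (φ ⇒ ψ)) ⇔ (Λ ⨾ (Φ ∪｛ φ ｝) ⊢L ψ)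
    local-deduction {φ} = mk⇔ to from
      where
      to : ∀ {ψ} → Λ ⨾ Φ ⊢L (φ ⇒ ψ) → Λ ⨾ (Φ ∪｛ φ ｝) ⊢L ψ
      to (γs , hs , d) =
        φ ∷ γs , inj₂ refl ∷ All.map inj₁ hs ,
        tautological-mp d λ f → ⇛-intro (φ ∷ γs) λ { (p ∷ ps) → ⇒-elim (⇛-elim γs f ps) p }

      from : ∀ {ψ} → Λ ⨾ (Φ ∪｛ φ ｝) ⊢L ψ → Λ ⨾ Φ ⊢L (φ ⇒ ψ)
      from (γs , hs , d) with All-∪｛｝ hs
      ... | δs , gs , cover =
        δs , gs , tautological-mp d λ f → ⇛-intro δs λ ps → ⇒-intro λ p → ⇛-elim γs f (cover p ps)

  module _ {Λ Γ : FSet} where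

    box-discharge : ∀ {ss s u} (σ : Sym ss s) (i : u ∈ ss) (ψs : All Form ss) {γs χ} →
                    All ((Γ ᴳ) u) γs →
                    Λ ⨾ (Γ ᴳ) s ⊢L box σ (ψs [ i ≔ curry γs χ ]) →
                    Λ ⨾ (Γ ᴳ) s ⊢L box σ (ψs [ i ≔ χ ])
    box-discharge σ i ψs []       d = d
    box-discharge σ i ψs (g ∷ gs) d =
      box-discharge σ i ψs gs
        (local-mp (local-mp (local-thm (ax (distribution σ i ψs _ _))) d) (local-hyp (step σ i ψs g)))

    global⇒local : ∀ {s} {χ : Form s} → Λ ⨾ Γ ⊢G χ → Λ ⨾ (Γ ᴳ) s ⊢L χ
    global⇒local (ax k)   = local-thm (ax k)
    global⇒local (hyp h)  = local-hyp (base h)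
    global⇒local (mp d e) = local-mp (global⇒local d) (global⇒local e)
    global⇒local (ug σ i ψs d) with global⇒local d
    ... | γs , hs , e = box-discharge σ i ψs hs (local-thm (ug σ i ψs (⇛⇒curry γs e)))

    local⇒global : ∀ {s} {χ : Form s} → Λ ⨾ (Γ ᴳ) s ⊢L χ → Λ ⨾ Γ ⊢G χ
    local⇒global (γs , hs , d) =
      mp-all (All.map ᴳ⇒derivable hs) (theorem⇒derivable (⇛⇒curry γs d))

    global⇔local : ∀ {s} {χ : Form s} → (Λ ⨾ Γ ⊢G χ) ⇔ (Λ ⨾ (Γ ᴳ) s ⊢L χ)
    global⇔local = mk⇔ global⇒local local⇒global

mainTheorem6 : (S : Set) (Sym : List S → S → Set) (P : S → Set) → ((s : S) → P s) →
    let open Logic S Sym P in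
    (Λ Γ : FSet) (s : S) (φ ψ : Form s) →
    (Λ ⨾ Γ ⊢G (φ ⇒ ψ)) ⇔ (Λ ⨾ ((Γ ᴳ) s ∪｛ φ ｝) ⊢L ψ)
mainTheorem6 S Sym P _ Λ Γ s φ ψ = local-deduction ⇔-∘ global⇔local
  where open Deduction S Sym P
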